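{- Let $\mathcal{P}=(Q,\delta)$ be an MFDO protocol, let $L'$ and $L$ be multisets of states of $\mathcal{P}$, and let $C'\to^* C$ be an execution of $\mathcal{P}$ such that $L'\le C'$ and $C\ge L$. Then there exist configurations $D'$ and $D$ such that $L'\le D'\le C'$, $L\le D\le C$, $D'\to^* D$, and $|D'|=|D|\le |L|+|L'|+|Q|^3$.
   Context: A message-free delayed observation (MFDO) protocol is a pair $(Q,\delta)$ with $Q$ a finite set of states and $\delta$ a set of transitions written $q\xrightarrow{o}q'$ with $q,o,q'\in Q$. Configurations are multisets over $Q$ (maps $Q\to\mathbb{N}$), with size $|C|=\sum_qC(q)$. Finite executions are defined inductively: every configuration $C_0$ is a finite execution; a finite execution $C_0,\dots,C_i$ enables $q\xrightarrow{o}q'$ if $C_i(q)\ge1$ and $C_j(o)\ge 1$ for some $j\le i$, and in that case $C_0,\dots,C_i,C_{i+1}$ is a finite execution with $C_{i+1}=C_i-\{\!\{q\}\!\}+\{\!\{q'\}\!\}$. We write $C\to^* C'$ if there is a finite execution starting at $C$ and ending at $C'$. -}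

module Defs where

open import Data.Nat using (ℕ; zero; suc; _+_; _∸_; _≤_; _^_)
open import Data.Fin using (Fin; _≟_)
open import Data.Product using (_×_; _,_; Σ; ∃-syntax)
open import Data.List using (List; []; _∷_)
open import Data.Nat.ListAction using (sum)
open import Data.List.Membership.Propositional using (_∈_)
open import Data.List.Relation.Unary.Any using (Any)
import Data.List as L
open import Relation.Nullary using (does)
open import Data.Bool using (if_then_else_)
open import Relation.Binary.PropositionalEquality using (_≡_)

-- An MFDO protocol with state set Q = Fin n (so |Q| = n) and a finite set
-- of transitions  q --o--> q'  given as a list of triples (q , o , q').
record MFDO : Set where
  field
    n : ℕ
    δ : List (Fin n × Fin n × Fin n)
open MFDO public

Config : ℕ → Set
Config n = Fin n → ℕ

size : ∀ {n} → Config n → ℕ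
size {n} C = sum (L.map C (L.allFin n))

_≤ᴹ_ : ∀ {n} → Config n → Config n → Set
C ≤ᴹ D = ∀ q → C q ≤ D q

_+ᴹ_ : ∀ {n} → Config n → Config n → Config n
(C +ᴹ D) q = C q + D q

⟦_⟧ : ∀ {n} → Fin n → Config n
⟦ p ⟧ q = if does (p ≟ q) then 1 else 0

-- C - {{q}} + {{q'}}   (used only when C(q) ≥ 1)
step : ∀ {n} → Config n → Fin n → Fin n → Config n
step C q q' r = (C r ∸ ⟦ q ⟧ r) + ⟦ q' ⟧ r

-- A finite execution C₀,…,Cᵢ, indexed by its first and last configuration
-- and the list of all its configurations (most recent first).
data Execution (P : MFDO) (C₀ : Config (n P)) :
       Config (n P) → List (Config (n P)) → Set where
  start : Execution P C₀ C₀ (C₀ ∷ [])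
  extend : ∀ {Cᵢ hist} q o q' →
           Execution P C₀ Cᵢ hist →
           (q , o , q') ∈ δ P →
           1 ≤ Cᵢ q →
           Any (λ Cⱼ → 1 ≤ Cⱼ o) hist →
           Execution P C₀ (step Cᵢ q q') (step Cᵢ q q' ∷ hist)

_⊢_→*_ : (P : MFDO) → Config (n P) → Config (n P) → Set
P ⊢ C →* C' = ∃[ hist ] Execution P C C' hist

module Submission where

-- We prove a stronger, generalised statement by induction on the
-- execution C' →* C: for every lower bound L ≤ C there is a run D' →* D with
-- L' ≤ D' ≤ C', L ≤ D ≤ C, |D'| = |D| and
--     |D| ≤ |L| + |L'| + #(states occurring somewhere along the execution),
-- and moreover every state occurring in the execution also occurs in the run
-- (so each observation needed to fire a transition stays available).
-- Base case: D = D' = L ⊔ L' ⊔ supp C'.  Step case, for C = C₁ - q + q'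
-- by a transition q --o--> q': if L needs an agent in q', pull L back to
-- L - q' + q ≤ C₁ and fire the same transition in the smaller run; if not and
-- q' occurred before, either fire the transition (when the run has a spare
-- agent in q) or keep the run unchanged; if q' is new, add one agent in q' to
-- L, paid for by the growth of the set of occurring states.

open import Defs
open import Data.Nat using (ℕ; zero; suc; _+_; _∸_; _≤_; _^_; _⊔_; z≤n; s≤s; _≤?_; _<?_)
open import Data.Nat.Properties hiding (_≟_)
open import Data.Nat.ListAction using (sum)
open import Data.Nat.Tactic.RingSolver using (solve-∀)
open import Data.Fin using (Fin; _≟_) renaming (zero to fzero; suc to fsuc)
open import Data.List using (List; []; _∷_; map; length; allFin)
open import Data.List.Properties using (map-tabulate; length-tabulate)
open import Data.List.Relation.Unary.Any using (Any; here; there; any?)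
open import Data.List.Membership.Propositional using (_∈_)
open import Data.Product using (_×_; _,_; ∃-syntax)
open import Data.Sum using (_⊎_; inj₁; inj₂)
open import Relation.Nullary using (¬_; Dec; yes; no)
open import Relation.Nullary.Negation using (contradiction)
open import Relation.Binary.PropositionalEquality
open import Function using (_∘_)

sumMap-mono : ∀ {A : Set} {f g : A → ℕ} (xs : List A) →
              (∀ x → f x ≤ g x) → sum (map f xs) ≤ sum (map g xs)
sumMap-mono []       f≤g = z≤n
sumMap-mono (x ∷ xs) f≤g = +-mono-≤ (f≤g x) (sumMap-mono xs f≤g)

sumMap-+ : ∀ {A : Set} (f g : A → ℕ) (xs : List A) →
           sum (map (λ x → f x + g x) xs) ≡ sum (map f xs) + sum (map g xs)
sumMap-+ f g []       = refl
sumMap-+ f g (x ∷ xs) = begin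
  f x + g x + sum (map (λ x → f x + g x) xs)     ≡⟨ cong (f x + g x +_) (sumMap-+ f g xs) ⟩
  f x + g x + (sum (map f xs) + sum (map g xs))  ≡⟨ +-interchange (f x) (g x) _ _ ⟩
  f x + sum (map f xs) + (g x + sum (map g xs))  ∎
  where
  open ≡-Reasoning
  +-interchange : ∀ a b c d → a + b + (c + d) ≡ a + c + (b + d)
  +-interchange = solve-∀

sumMap-≤length : ∀ {A : Set} (f : A → ℕ) (xs : List A) →
                 (∀ x → f x ≤ 1) → sum (map f xs) ≤ length xs
sumMap-≤length f []       f≤1 = z≤n
sumMap-≤length f (x ∷ xs) f≤1 = +-mono-≤ (f≤1 x) (sumMap-≤length f xs f≤1)

sumMap-0 : ∀ {A : Set} (f : A → ℕ) (xs : List A) → (∀ x → f x ≡ 0) → sum (map f xs) ≡ 0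
sumMap-0 f []       f≡0 = refl
sumMap-0 f (x ∷ xs) f≡0 = cong₂ _+_ (f≡0 x) (sumMap-0 f xs f≡0)

size-mono : ∀ {m} {X Y : Config m} → X ≤ᴹ Y → size X ≤ size Y
size-mono {m} = sumMap-mono (allFin m)

size-+ : ∀ {m} (X Y : Config m) → size (X +ᴹ Y) ≡ size X + size Y
size-+ {m} X Y = sumMap-+ X Y (allFin m)

size-cong : ∀ {m} {X Y : Config m} → (∀ r → X r ≡ Y r) → size X ≡ size Y
size-cong X≗Y = ≤-antisym (size-mono (≤-reflexive ∘ X≗Y)) (size-mono (≤-reflexive ∘ sym ∘ X≗Y))

size-≤1 : ∀ {m} (X : Config m) → (∀ r → X r ≤ 1) → size X ≤ m
size-≤1 {m} X X≤1 = subst (size X ≤_) (length-tabulate {n = m} (λ i → i))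
                          (sumMap-≤length X (allFin m) X≤1)

size-suc : ∀ {m} (C : Config (suc m)) → size C ≡ C fzero + size (λ r → C (fsuc r))
size-suc {m} C = cong (λ xs → C fzero + sum xs)
  (trans (map-tabulate fsuc C) (sym (map-tabulate (λ i → i) (λ r → C (fsuc r)))))

⟦⟧-self : ∀ {m} (p : Fin m) → ⟦ p ⟧ p ≡ 1
⟦⟧-self p with p ≟ p
... | yes _   = refl
... | no p≢p  = contradiction refl p≢p

⟦⟧-other : ∀ {m} {p r : Fin m} → ¬ p ≡ r → ⟦ p ⟧ r ≡ 0
⟦⟧-other {p = p} {r} p≢r with p ≟ r
... | yes p≡r = contradiction p≡r p≢r
... | no _    = refl

⟦⟧-≤ : ∀ {m} (X : Config m) {p} → 1 ≤ X p → ⟦ p ⟧ ≤ᴹ X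
⟦⟧-≤ X {p} Xp r with p ≟ r
... | yes refl = Xp
... | no _     = z≤n

size-⟦⟧ : ∀ {m} (p : Fin m) → size ⟦ p ⟧ ≡ 1
size-⟦⟧ {suc m} fzero    = trans (size-suc {m} ⟦ fzero ⟧) (cong suc (sumMap-0 (λ r → ⟦ fzero ⟧ (fsuc r)) (allFin m) (λ _ → refl)))
size-⟦⟧ {suc m} (fsuc p) = trans (size-suc {m} ⟦ fsuc p ⟧) (size-⟦⟧ p)

add-missing : ∀ {m} {X Y : Config m} {p} → X p ≡ 0 → 1 ≤ Y p → X ≤ᴹ Y → (X +ᴹ ⟦ p ⟧) ≤ᴹ Y
add-missing {X = X} {Y} {p} Xp≡0 Yp X≤Y r with p ≟ r
... | yes refl = subst (λ k → k + 1 ≤ Y p) (sym Xp≡0) Yp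
... | no _     = subst (_≤ Y r) (sym (+-identityʳ (X r))) (X≤Y r)

step-mono : ∀ {m} {X Y : Config m} a b → X ≤ᴹ Y → step X a b ≤ᴹ step Y a b
step-mono a b X≤Y r = +-monoˡ-≤ (⟦ b ⟧ r) (∸-monoˡ-≤ (⟦ a ⟧ r) (X≤Y r))

step-target : ∀ {m} (X : Config m) a b → 1 ≤ step X a b b
step-target X a b = subst (_≤ step X a b b) (⟦⟧-self b) (m≤n+m (⟦ b ⟧ b) (X b ∸ ⟦ a ⟧ b))

step-≤-off : ∀ {m} (X : Config m) a {b r} → ¬ b ≡ r → step X a b r ≤ X r
step-≤-off X a {b} {r} b≢r =
  subst (_≤ X r) (cong (X r ∸ ⟦ a ⟧ r +_) (sym (⟦⟧-other b≢r)))
        (subst (_≤ X r) (sym (+-identityʳ _)) (m∸n≤m (X r) (⟦ a ⟧ r)))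

step-≥-off : ∀ {m} (X : Config m) {a} b {r} → ¬ a ≡ r → X r ≤ step X a b r
step-≥-off X b {r} a≢r = subst (λ k → X r ≤ X r ∸ k + ⟦ b ⟧ r) (sym (⟦⟧-other a≢r)) (m≤m+n (X r) (⟦ b ⟧ r))

step-+ : ∀ {m} (X : Config m) {a} b → 1 ≤ X a → ∀ r → step X a b r + ⟦ a ⟧ r ≡ X r + ⟦ b ⟧ r
step-+ X {a} b Xa r = begin
  X r ∸ ⟦ a ⟧ r + ⟦ b ⟧ r + ⟦ a ⟧ r   ≡⟨ +-assoc (X r ∸ ⟦ a ⟧ r) _ _ ⟩
  X r ∸ ⟦ a ⟧ r + (⟦ b ⟧ r + ⟦ a ⟧ r) ≡⟨ cong (X r ∸ ⟦ a ⟧ r +_) (+-comm (⟦ b ⟧ r) _) ⟩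
  X r ∸ ⟦ a ⟧ r + (⟦ a ⟧ r + ⟦ b ⟧ r) ≡⟨ sym (+-assoc (X r ∸ ⟦ a ⟧ r) _ _) ⟩
  X r ∸ ⟦ a ⟧ r + ⟦ a ⟧ r + ⟦ b ⟧ r   ≡⟨ cong (_+ ⟦ b ⟧ r) (m∸n+n≡m (⟦⟧-≤ X Xa r)) ⟩
  X r + ⟦ b ⟧ r                       ∎
  where open ≡-Reasoning

step-inverse : ∀ {m} (X : Config m) {a} b → 1 ≤ X a → ∀ r → step (step X a b) b a r ≡ X r
step-inverse X {a} b Xa r =
  trans (cong (_+ ⟦ a ⟧ r) (m+n∸n≡m (X r ∸ ⟦ a ⟧ r) (⟦ b ⟧ r))) (m∸n+n≡m (⟦⟧-≤ X Xa r))

size-step : ∀ {m} (X : Config m) {a} b → 1 ≤ X a → size (step X a b) ≡ size X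
size-step X {a} b Xa = +-cancelʳ-≡ 1 _ _ (begin
  size (step X a b) + 1             ≡⟨ cong (size (step X a b) +_) (sym (size-⟦⟧ a)) ⟩
  size (step X a b) + size ⟦ a ⟧    ≡⟨ sym (size-+ (step X a b) ⟦ a ⟧) ⟩
  size (step X a b +ᴹ ⟦ a ⟧)        ≡⟨ size-cong (step-+ X b Xa) ⟩
  size (X +ᴹ ⟦ b ⟧)                 ≡⟨ size-+ X ⟦ b ⟧ ⟩
  size X + size ⟦ b ⟧               ≡⟨ cong (size X +_) (size-⟦⟧ b) ⟩
  size X + 1                        ∎)
  where open ≡-Reasoning

Occurs : ∀ {m} → List (Config m) → Fin m → Set
Occurs hist r = Any (λ X → 1 ≤ X r) hist

occurs? : ∀ {m} (hist : List (Config m)) r → Dec (Occurs hist r)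
occurs? hist r = any? (λ X → 1 ≤? X r) hist

occurring : ∀ {m} → List (Config m) → Config m
occurring hist r with occurs? hist r
... | yes _ = 1
... | no _  = 0

occurring-≤1 : ∀ {m} (hist : List (Config m)) r → occurring hist r ≤ 1
occurring-≤1 hist r with occurs? hist r
... | yes _ = ≤-refl
... | no _  = z≤n

occurring-sound : ∀ {m} {hist : List (Config m)} {r} → Occurs hist r → 1 ≤ occurring hist r
occurring-sound {hist = hist} {r} occ with occurs? hist r
... | yes _   = ≤-refl
... | no ¬occ = contradiction occ ¬occ

occurring-single : ∀ {m} (X : Config m) → occurring (X ∷ []) ≤ᴹ X
occurring-single X r with occurs? (X ∷ []) r
... | yes (here Xr) = Xr
... | no _          = z≤n

occurring-grow : ∀ {m} (X : Config m) hist → occurring hist ≤ᴹ occurring (X ∷ hist)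
occurring-grow X hist r with occurs? hist r | occurs? (X ∷ hist) r
... | yes _   | yes _    = ≤-refl
... | yes occ | no ¬occ  = contradiction (there occ) ¬occ
... | no _    | _        = z≤n

occurring-new : ∀ {m} (X : Config m) hist {p} → ¬ Occurs hist p → 1 ≤ X p →
                (occurring hist +ᴹ ⟦ p ⟧) ≤ᴹ occurring (X ∷ hist)
occurring-new X hist {p} new Xp r with p ≟ r
... | yes refl = subst (λ k → k + 1 ≤ occurring (X ∷ hist) p) (sym (not-occurring new))
                       (occurring-sound (here Xp))
  where
  not-occurring : ∀ {r} → ¬ Occurs hist r → occurring hist r ≡ 0
  not-occurring {r} ¬occ with occurs? hist r
  ... | yes occ = contradiction occ ¬occ
  ... | no _    = refl
... | no _     = subst (_≤ occurring (X ∷ hist) r) (sym (+-identityʳ _)) (occurring-grow X hist r)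

module Shrinking (P : MFDO) where

  Cfg : Set
  Cfg = Config (n P)

  last-occurs : ∀ {X Y : Cfg} {hist} → Execution P X Y hist → ∀ r → 1 ≤ Y r → Occurs hist r
  last-occurs start                     r Yr = here Yr
  last-occurs (extend _ _ _ _ _ _ _) r Yr = here Yr

  occurs-after-step : ∀ {C' C₁ : Cfg} {hist} q q' → Execution P C' C₁ hist →
                      ∀ r → Occurs (step C₁ q q' ∷ hist) r → q' ≡ r ⊎ Occurs hist r
  occurs-after-step q q' run r (there occ) = inj₂ occ
  occurs-after-step {C₁ = C₁} {hist} q q' run r (here Cr) = decide (q' ≟ r)
    where
    decide : Dec (q' ≡ r) → q' ≡ r ⊎ Occurs hist r
    decide (yes q'≡r) = inj₁ q'≡r
    decide (no q'≢r)  = inj₂ (last-occurs run r (≤-trans Cr (step-≤-off C₁ q q'≢r)))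

  record SmallRun (C' C : Cfg) (hist : List Cfg) (L' L : Cfg) (B : ℕ) : Set where
    constructor smallRun
    field
      D' D     : Cfg
      hist'    : List Cfg
      run      : Execution P D' D hist'
      L'≤D'    : L' ≤ᴹ D'
      D'≤C'    : D' ≤ᴹ C'
      L≤D      : L ≤ᴹ D
      D≤C      : D ≤ᴹ C
      size≡    : size D' ≡ size D
      size≤    : size D ≤ B
      observes : ∀ r → Occurs hist r → Occurs hist' r

  weaken : ∀ {C' C hist L' L L₂ B B₂} → L₂ ≤ᴹ L → B ≤ B₂ →
           SmallRun C' C hist L' L B → SmallRun C' C hist L' L₂ B₂
  weaken L₂≤L B≤B₂ (smallRun D' D hist' run L'≤D' D'≤C' L≤D D≤C size≡ size≤ observes) =
    smallRun D' D hist' run L'≤D' D'≤C' (λ r → ≤-trans (L₂≤L r) (L≤D r)) D≤C size≡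
             (≤-trans size≤ B≤B₂) observes

  budget : List Cfg → Cfg → Cfg → ℕ
  budget hist L' L = size L + size L' + size (occurring hist)

  shrink-start : ∀ {C' : Cfg} {L' L} → L' ≤ᴹ C' → L ≤ᴹ C' →
                 SmallRun C' C' (C' ∷ []) L' L (budget (C' ∷ []) L' L)
  shrink-start {C'} {L'} {L} L'≤C' L≤C' =
    smallRun D D (D ∷ []) start
      (λ r → ≤-trans (m≤m⊔n (L' r) _) (m≤n⊔m (L r) _)) D≤C'
      (λ r → m≤m⊔n (L r) _) D≤C' refl size≤ observes
    where
    S = occurring (C' ∷ [])
    D : Cfg
    D r = L r ⊔ (L' r ⊔ S r)
    D≤C' : D ≤ᴹ C'
    D≤C' r = ⊔-lub (L≤C' r) (⊔-lub (L'≤C' r) (occurring-single C' r))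
    D≤sum : D ≤ᴹ ((L +ᴹ L') +ᴹ S)
    D≤sum r = ≤-trans (m⊔n≤m+n (L r) _)
                (≤-trans (+-monoʳ-≤ (L r) (m⊔n≤m+n (L' r) (S r))) (≤-reflexive (sym (+-assoc (L r) _ _))))
    size≤ : size D ≤ budget (C' ∷ []) L' L
    size≤ = ≤-trans (size-mono D≤sum)
              (≤-reflexive (trans (size-+ (L +ᴹ L') S) (cong (_+ size S) (size-+ L L'))))
    observes : ∀ r → Occurs (C' ∷ []) r → Occurs (D ∷ []) r
    observes r occ = here (≤-trans (occurring-sound occ) (≤-trans (m≤n⊔m (L' r) _) (m≤n⊔m (L r) _)))

  module Step {C' C₁ : Cfg} {hist} (q o q' : Fin (n P)) (run₁ : Execution P C' C₁ hist)
              (t : (q , o , q') ∈ δ P) (enabled : 1 ≤ C₁ q) (observed : Occurs hist o)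
              (L' : Cfg)
              (ih : ∀ L₁ → L₁ ≤ᴹ C₁ → SmallRun C' C₁ hist L' L₁ (budget hist L' L₁)) where

    C : Cfg
    C = step C₁ q q'

    fire : ∀ {L₁ L B} (R : SmallRun C' C₁ hist L' L₁ B) → 1 ≤ SmallRun.D R q →
           L ≤ᴹ step (SmallRun.D R) q q' → SmallRun C' C (C ∷ hist) L' L B
    fire (smallRun D' D hist' run L'≤D' D'≤C' L≤D D≤C size≡ size≤ observes) Dq L≤D₂ =
      smallRun D' D₂ (D₂ ∷ hist') (extend q o q' run t Dq (observes o observed))
        L'≤D' D'≤C' L≤D₂ (step-mono q q' D≤C)
        (trans size≡ (sym (size-step D q' Dq)))
        (≤-trans (≤-reflexive (size-step D q' Dq)) size≤) observes₂
      where
      D₂ = step D q q'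
      observes₂ : ∀ r → Occurs (C ∷ hist) r → Occurs (D₂ ∷ hist') r
      observes₂ r occ with occurs-after-step q q' run₁ r occ
      ... | inj₁ refl = here (step-target D q q')
      ... | inj₂ occ₁ = there (observes r occ₁)

    keep : ∀ {L B} (R : SmallRun C' C₁ hist L' L B) → SmallRun.D R q ≤ C q →
           Occurs hist q' → SmallRun C' C (C ∷ hist) L' L B
    keep (smallRun D' D hist' run L'≤D' D'≤C' L≤D D≤C size≡ size≤ observes) Dq≤Cq old =
      smallRun D' D hist' run L'≤D' D'≤C' L≤D D≤C₂ size≡ size≤ observes₂
      where
      D≤C₂ : D ≤ᴹ C
      D≤C₂ r = decide (q ≟ r)
        where
        decide : Dec (q ≡ r) → D r ≤ C r
        decide (yes refl) = Dq≤Cq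
        decide (no q≢r)   = ≤-trans (D≤C r) (step-≥-off C₁ q' q≢r)
      observes₂ : ∀ r → Occurs (C ∷ hist) r → Occurs hist' r
      observes₂ r occ with occurs-after-step q q' run₁ r occ
      ... | inj₁ refl = observes q' old
      ... | inj₂ occ₁ = observes r occ₁

    pull-back : ∀ L → L ≤ᴹ C → 1 ≤ L q' → SmallRun C' C (C ∷ hist) L' L (budget hist L' L)
    pull-back L L≤C Lq' = fire R (≤-trans (step-target L q' q) (SmallRun.L≤D R q)) L≤D₂
      where
      L₁ = step L q' q
      L₁≤C₁ : L₁ ≤ᴹ C₁
      L₁≤C₁ r = subst (L₁ r ≤_) (step-inverse C₁ q' enabled r) (step-mono q' q L≤C r)
      R : SmallRun C' C₁ hist L' L₁ (budget hist L' L)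
      R = subst (λ k → SmallRun C' C₁ hist L' L₁ (k + size L' + size (occurring hist)))
                (size-step L q Lq') (ih L₁ L₁≤C₁)
      L≤D₂ : L ≤ᴹ step (SmallRun.D R) q q'
      L≤D₂ r = subst (_≤ step (SmallRun.D R) q q' r) (step-inverse L q Lq' r) (step-mono q q' (SmallRun.L≤D R) r)

    reuse : ∀ L → L ≤ᴹ C → L q' ≡ 0 → Occurs hist q' → SmallRun C' C (C ∷ hist) L' L (budget hist L' L)
    reuse L L≤C Lq'≡0 old = fire-or-keep (ih L L≤C₁)
      where
      L≤C₁ : L ≤ᴹ C₁
      L≤C₁ r with q' ≟ r
      ... | yes refl = subst (_≤ C₁ q') (sym Lq'≡0) z≤n
      ... | no q'≢r  = ≤-trans (L≤C r) (step-≤-off C₁ q q'≢r)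
      fire-or-keep : ∀ {B} → SmallRun C' C₁ hist L' L B → SmallRun C' C (C ∷ hist) L' L B
      fire-or-keep R with L q <? SmallRun.D R q
      ... | yes Lq<Dq = fire R (≤-trans (s≤s z≤n) Lq<Dq) L≤D₂
        where
        L≤D₂ : L ≤ᴹ step (SmallRun.D R) q q'
        L≤D₂ r = decide (q ≟ r)
          where
          decide : Dec (q ≡ r) → L r ≤ step (SmallRun.D R) q q' r
          decide (yes refl) = ≤-trans (subst (L q ≤_) (cong (SmallRun.D R q ∸_) (sym (⟦⟧-self q)))
                                                   (∸-monoˡ-≤ 1 Lq<Dq))
                                      (m≤m+n _ _)
          decide (no q≢r)   = ≤-trans (SmallRun.L≤D R r) (step-≥-off (SmallRun.D R) q' q≢r)
      ... | no Lq≮Dq = keep R (≤-trans (≮⇒≥ Lq≮Dq) (L≤C q)) old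

    -- L has no agent in q', which is new: demand one agent in q' anyway,
    -- paid for by q' joining the occurring states.
    add-new : ∀ L → L ≤ᴹ C → L q' ≡ 0 → ¬ Occurs hist q' →
              SmallRun C' C (C ∷ hist) L' L (budget (C ∷ hist) L' L)
    add-new L L≤C Lq'≡0 new =
      weaken (λ r → m≤m+n (L r) _) budget≤
        (pull-back L⁺ (add-missing Lq'≡0 (step-target C₁ q q') L≤C)
                      (subst (_≤ L⁺ q') (⟦⟧-self q') (m≤n+m _ (L q'))))
      where
      L⁺ = L +ᴹ ⟦ q' ⟧
      rearrange : ∀ a b s → a + 1 + b + s ≡ a + b + (s + 1)
      rearrange = solve-∀
      budget≤ : budget hist L' L⁺ ≤ budget (C ∷ hist) L' L
      budget≤ = begin
        size L⁺ + size L' + size (occurring hist)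
          ≡⟨ cong (λ k → k + size L' + size (occurring hist)) (trans (size-+ L ⟦ q' ⟧) (cong (size L +_) (size-⟦⟧ q'))) ⟩
        size L + 1 + size L' + size (occurring hist)
          ≡⟨ rearrange (size L) (size L') (size (occurring hist)) ⟩
        size L + size L' + (size (occurring hist) + 1)
          ≡⟨ cong (size L + size L' +_) (sym (trans (size-+ (occurring hist) ⟦ q' ⟧) (cong (_ +_) (size-⟦⟧ q')))) ⟩
        size L + size L' + size (occurring hist +ᴹ ⟦ q' ⟧)
          ≤⟨ +-monoʳ-≤ (size L + size L') (size-mono (occurring-new C hist new (step-target C₁ q q'))) ⟩
        size L + size L' + size (occurring (C ∷ hist)) ∎
        where open ≤-Reasoning

    budget-grows : ∀ L → budget hist L' L ≤ budget (C ∷ hist) L' L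
    budget-grows L = +-monoʳ-≤ (size L + size L') (size-mono (occurring-grow C hist))

    shrink-step : ∀ L → L ≤ᴹ C → SmallRun C' C (C ∷ hist) L' L (budget (C ∷ hist) L' L)
    shrink-step L L≤C with 1 ≤? L q' | occurs? hist q'
    ... | yes Lq' | _       = weaken (λ _ → ≤-refl) (budget-grows L) (pull-back L L≤C Lq')
    ... | no Lq'≱1 | yes old = weaken (λ _ → ≤-refl) (budget-grows L) (reuse L L≤C (n<1⇒n≡0 (≰⇒> Lq'≱1)) old)
    ... | no Lq'≱1 | no new  = add-new L L≤C (n<1⇒n≡0 (≰⇒> Lq'≱1)) new

  shrink : ∀ {C' C : Cfg} {hist} → Execution P C' C hist → ∀ {L'} → L' ≤ᴹ C' →
           ∀ L → L ≤ᴹ C → SmallRun C' C hist L' L (budget hist L' L)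
  shrink start L'≤C' L L≤C = shrink-start L'≤C' L≤C
  shrink (extend q o q' run t enabled observed) {L'} L'≤C' =
    Step.shrink-step q o q' run t enabled observed L' (λ L₁ L₁≤C₁ → shrink run L'≤C' L₁ L₁≤C₁)

-- The cubic bound of the theorem is weaker than the linear one proved.
n≤n^3 : ∀ k → k ≤ k ^ 3
n≤n^3 zero       = z≤n
n≤n^3 k@(suc _) = m≤m*n k (k ^ 2) {{m^n≢0 k 2}}

theorem5 : (P : MFDO) (L' L C' C : Config (n P)) →
           P ⊢ C' →* C → L' ≤ᴹ C' → L ≤ᴹ C →
           ∃[ D' ] ∃[ D ] ((L' ≤ᴹ D' × D' ≤ᴹ C') × (L ≤ᴹ D × D ≤ᴹ C) ×
             P ⊢ D' →* D × size D' ≡ size D ×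
             size D ≤ size L + size L' + n P ^ 3)
theorem5 P L' L C' C (hist , run) L'≤C' L≤C =
  D' , D , (L'≤D' , D'≤C') , (L≤D , D≤C) , (hist' , SmallRun.run R) , size≡ ,
  ≤-trans size≤ (+-monoʳ-≤ (size L + size L') occurring≤n³)
  where
  open Shrinking P
  R = shrink run L'≤C' L L≤C
  open SmallRun R using (D'; D; hist'; L'≤D'; D'≤C'; L≤D; D≤C; size≡; size≤)
  occurring≤n³ : size (occurring hist) ≤ n P ^ 3
  occurring≤n³ = ≤-trans (size-≤1 (occurring hist) (occurring-≤1 hist)) (n≤n^3 (n P))
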